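{- Let $a,b$ be integers with $a-1>b\ge 1$ and let $u_\beta$ be the fixed point $\lim_{n\to\infty}\varphi^n(0)$ of the substitution $\varphi(0)=0^a1$, $\varphi(1)=0^b1$. Then $$\mathcal P(n+1)+\mathcal P(n)=\Delta\mathcal C(n)+2\qquad\text{for all } n\in\mathbb N.$$
   Context: $\mathcal C(n)$ is the number of distinct factors of $u_\beta$ of length $n$, and $\Delta\mathcal C(n)=\mathcal C(n+1)-\mathcal C(n)$. $\mathcal P(n)$ is the number of distinct palindromic factors (words equal to their reversal) of $u_\beta$ of length $n$. -}

module Defs where

open import Data.Nat using (ℕ; zero; suc; _+_)
open import Data.List using (List; []; _∷_; _++_; [_]; replicate; concatMap; length; reverse; lookup)
open import Data.List.Membership.Propositional using (_∈_)
open import Data.List.Relation.Unary.Unique.Propositional using (Unique)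
open import Data.Product using (Σ; ∃; _×_)
open import Function.Bundles using (_⇔_)
open import Relation.Binary.PropositionalEquality using (_≡_)

-- Words over the alphabet {0,1}, letters represented as natural numbers.
Word : Set
Word = List ℕ

-- The substitution φ(0) = 0^a 1, φ(1) = 0^b 1 (letter 1 is any nonzero letter;
-- only the letters 0 and 1 ever occur).
φ : ℕ → ℕ → ℕ → Word
φ a b zero    = replicate a 0 ++ [ 1 ]
φ a b (suc _) = replicate b 0 ++ [ 1 ]

φ* : ℕ → ℕ → Word → Word
φ* a b = concatMap (φ a b)

iter : ℕ → ℕ → ℕ → Word → Word
iter a b zero    w = w
iter a b (suc n) w = φ* a b (iter a b n w)

at : Word → ℕ → ℕ
at []      _       = 0
at (x ∷ _) zero    = x
at (_ ∷ w) (suc i) = at w i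

-- The fixed point u_β = lim φ^n(0): its i-th letter is the i-th letter of
-- φ^(i+1)(0), which has length > i (every image has length ≥ 2) and is a
-- prefix of all longer iterates (φ(0) starts with 0).
u : ℕ → ℕ → ℕ → ℕ
u a b i = at (iter a b (suc i) [ 0 ]) i

window : (ℕ → ℕ) → ℕ → ℕ → Word
window s i zero    = []
window s i (suc n) = s i ∷ window s (suc i) n

IsFactor : (ℕ → ℕ) → Word → Set
IsFactor s w = ∃ λ i → window s i (length w) ≡ w

IsPalindrome : Word → Set
IsPalindrome w = w ≡ reverse w

HasCard : (Word → Set) → ℕ → Set
HasCard P k = Σ (List Word) λ L → Unique L × length L ≡ k × (∀ w → (w ∈ L) ⇔ P w)

ComplexityIs : ℕ → ℕ → ℕ → ℕ → Set
ComplexityIs a b n k = HasCard (λ w → length w ≡ n × IsFactor (u a b) w) k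

PalCountIs : ℕ → ℕ → ℕ → ℕ → Set
PalCountIs a b n k =
  HasCard (λ w → length w ≡ n × IsFactor (u a b) w × IsPalindrome w) k

{-# OPTIONS --safe #-}
-- Let T(v) = 0ᵇ 1 φ(v) 0ᵇ. The palindromes Tᵏ(0) are factors of u_β containing φᵏ(0), so the
-- language of u_β is closed under reversal. Reading off the runs of zeros, a bispecial factor is
-- either 0ᵏ or T(v) with v a shorter bispecial factor, and T preserves the extensions of v; by
-- induction every bispecial factor is a palindrome whose two-sided extensions are not exactly
-- {0w0, 1w1}. For such a language, counting the extensions of each word w gives
--   #{xwy} + [w] + [w palindromic] = #{xw} + #{wy} + #{x : xwx palindromic},
-- and summing over |w| = n yields C(n+2) + C(n) + P(n) = 2C(n+1) + P(n+2). With C(0) = P(0) = 1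
-- and C(1) = P(1) = 2 this telescopes to P(n+1) + P(n) = C(n+1) − C(n) + 2.
-- The counts are finite sums because membership is decidable: desubstituting |w| times shows that
-- every factor w already occurs in φ^(|w|+2)(0).
module Submission where

open import Defs
open import Data.Bool using (Bool; true; false; _∨_; if_then_else_)
open import Data.Empty using (⊥; ⊥-elim)
open import Data.List using (List; []; _∷_; _++_; [_]; _∷ʳ_; replicate; concatMap; length; reverse; map; _∷ʳ′_; initLast)
open import Data.List.Properties
  using ( ++-assoc; ++-identityʳ; ++-cancelˡ; ++-conicalˡ; ++-conicalʳ; ++-monoid; reverse-++; unfold-reverse
        ; ∷-injective; ∷-injectiveˡ; ∷-injectiveʳ; ∷ʳ-injectiveˡ; length-++; length-map; length-replicate; ≡-dec)
open import Data.List.Membership.Propositional using (_∈_)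
import Data.List.Membership.Propositional.Properties as ∈
open import Data.List.Relation.Unary.All using (All; []; _∷_; head)
import Data.List.Relation.Unary.All.Properties as All
open import Data.List.Relation.Unary.Any using (here)
open import Data.List.Relation.Unary.Unique.Propositional using (Unique)
open import Data.List.Relation.Unary.AllPairs using ([]; _∷_)
import Data.List.Relation.Unary.Unique.Propositional.Properties as Unique
open import Data.Nat using (ℕ; zero; suc; _+_; _≤_; _<_; z≤n; s≤s)
open import Data.Nat.Properties
  using ( _≟_; +-comm; +-suc; +-identityʳ; +-cancelʳ-≡; +-mono-≤; +-commutativeSemigroup; ≤-refl; ≤-trans; ≤-reflexive
        ; ≤-pred; <⇒≤; <-irrefl; n≤1+n; m≤n+m; m≤m+n; m≤n⇒∃[o]m+o≡n)
open import Data.Product using (∃; ∃₂; _×_; _,_; proj₁; proj₂)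
open import Data.Sum using (_⊎_; inj₁; inj₂; [_,_]′)
open import Function using (_∘_)
open import Function.Bundles using (_⇔_; mk⇔; Equivalence)
open import Function.Properties.Equivalence using () renaming (refl to ⇔-refl)
open import Data.Product.Function.NonDependent.Propositional using (_×-⇔_)
open import Relation.Binary.Definitions using (DecidableEquality)
open import Relation.Binary.PropositionalEquality using (_≡_; _≢_; refl; sym; trans; cong; cong₂; subst; module ≡-Reasoning)
open import Relation.Nullary using (¬_; Dec; yes; no; does)
open import Relation.Nullary.Decidable using (map′; _×-dec_; _⊎-dec_; dec-true; dec-false; does-⇔)
open import Relation.Unary using (Decidable)
open import Algebra.Properties.CommutativeSemigroup +-commutativeSemigroup using (interchange)
import Algebra.Solver.Monoid
import Data.Nat.Solver

private variable
  A : Set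

module ++-Solver {A : Set} = Algebra.Solver.Monoid (++-monoid A)

dec-true⁻¹ : (A? : Dec A) → does A? ≡ true → A
dec-true⁻¹ (yes a) _ = a

dec-false⁻¹ : (A? : Dec A) → does A? ≡ false → ¬ A
dec-false⁻¹ (no ¬a) _ = ¬a

++-overlap : (p q r s : List A) → p ++ q ≡ r ++ s →
  (∃ λ m → p ≡ r ++ m × s ≡ m ++ q) ⊎ (∃ λ m → r ≡ p ++ m × q ≡ m ++ s)
++-overlap []      q r       s eq = inj₂ (r , refl , eq)
++-overlap (x ∷ p) q []      s eq = inj₁ (x ∷ p , refl , sym eq)
++-overlap (x ∷ p) q (y ∷ r) s eq with refl , eq′ ← ∷-injective eq with ++-overlap p q r s eq′
... | inj₁ (m , p≡ , s≡) = inj₁ (m , cong (x ∷_) p≡ , s≡)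
... | inj₂ (m , r≡ , q≡) = inj₂ (m , cong (x ∷_) r≡ , q≡)

++-∷-view : ∀ (xs : List A) x ys → ∃₂ λ y zs → xs ++ x ∷ ys ≡ y ∷ zs
++-∷-view []       x ys = x , ys , refl
++-∷-view (z ∷ xs) x ys = z , xs ++ x ∷ ys , refl

∷-∷ʳ-view : ∀ (x : A) xs → ∃₂ λ ys y → x ∷ xs ≡ ys ∷ʳ y
∷-∷ʳ-view x xs with initLast xs
... | []       = [] , x , refl
... | ys ∷ʳ′ y = x ∷ ys , y , refl

[]≢++∷ : ∀ (p : List A) {x q} → [] ≢ p ++ x ∷ q
[]≢++∷ p eq with () ← ++-conicalʳ p _ (sym eq)

replicate-+ : ∀ m n (x : A) → replicate (m + n) x ≡ replicate m x ++ replicate n x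
replicate-+ zero    n x = refl
replicate-+ (suc m) n x = cong (x ∷_) (replicate-+ m n x)

replicate-∷ʳ : ∀ n (x : A) → replicate n x ∷ʳ x ≡ x ∷ replicate n x
replicate-∷ʳ zero    x = refl
replicate-∷ʳ (suc n) x = cong (x ∷_) (replicate-∷ʳ n x)

reverse-replicate : ∀ n (x : A) → reverse (replicate n x) ≡ replicate n x
reverse-replicate zero    x = refl
reverse-replicate (suc n) x = begin
  reverse (x ∷ replicate n x)      ≡⟨ unfold-reverse x (replicate n x) ⟩
  reverse (replicate n x) ∷ʳ x     ≡⟨ cong (_∷ʳ x) (reverse-replicate n x) ⟩
  replicate n x ∷ʳ x               ≡⟨ replicate-∷ʳ n x ⟩
  x ∷ replicate n x                ∎
  where open ≡-Reasoning

reverse-∷-∷ʳ : ∀ (x : A) w y → reverse (x ∷ w ++ [ y ]) ≡ y ∷ reverse w ++ [ x ]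
reverse-∷-∷ʳ x w y = begin
  reverse (x ∷ w ++ [ y ])     ≡⟨ unfold-reverse x (w ++ [ y ]) ⟩
  reverse (w ++ [ y ]) ∷ʳ x    ≡⟨ cong (_∷ʳ x) (reverse-++ w [ y ]) ⟩
  (y ∷ reverse w) ∷ʳ x         ∎
  where open ≡-Reasoning

-- Factors of finite words

infix 4 _⊑_

_⊑_ : List A → List A → Set
w ⊑ W = ∃₂ λ p s → p ++ w ++ s ≡ W

⊑-refl : (w : List A) → w ⊑ w
⊑-refl w = [] , [] , ++-identityʳ w

⊑-++ : ∀ (p w s : List A) → w ⊑ p ++ w ++ s
⊑-++ p w s = p , s , refl

⊑-∷ : ∀ (x : A) w → w ⊑ x ∷ w
⊑-∷ x w = [ x ] , [] , cong (x ∷_) (++-identityʳ w)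

⊑-∷ʳ : ∀ (w : List A) y → w ⊑ w ∷ʳ y
⊑-∷ʳ w y = [] , [ y ] , refl

⊑-trans : {u v w : List A} → u ⊑ v → v ⊑ w → u ⊑ w
⊑-trans {u = u} (p , s , refl) (p′ , s′ , refl) = p′ ++ p , s ++ s′ ,
  solve 5 (λ P′ P U S S′ → (P′ ⊕ P) ⊕ U ⊕ (S ⊕ S′) ⊜ P′ ⊕ (P ⊕ U ⊕ S) ⊕ S′) refl p′ p u s s′
  where open ++-Solver

⊑-reverse : {w W : List A} → w ⊑ W → reverse w ⊑ reverse W
⊑-reverse {w = w} (p , s , refl) = reverse s , reverse p , (begin
  reverse s ++ reverse w ++ reverse p   ≡⟨ cong (reverse s ++_) (reverse-++ p w) ⟨
  reverse s ++ reverse (p ++ w)         ≡⟨ reverse-++ (p ++ w) s ⟨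
  reverse ((p ++ w) ++ s)               ≡⟨ cong reverse (++-assoc p w s) ⟩
  reverse (p ++ w ++ s)                 ∎)
  where open ≡-Reasoning

All-⊑ : {P : A → Set} {w W : List A} → w ⊑ W → All P W → All P w
All-⊑ {w = w} (p , s , refl) all = All.++⁻ˡ w (All.++⁻ʳ p all)

⊑-homomorphism : (ψ : List A → List A) → (∀ v w → ψ (v ++ w) ≡ ψ v ++ ψ w) →
  {w W : List A} → w ⊑ W → ψ w ⊑ ψ W
⊑-homomorphism ψ ψ-++ {w} (p , s , refl) = ψ p , ψ s ,
  sym (trans (ψ-++ p (w ++ s)) (cong (ψ p ++_) (ψ-++ w s)))

++-prefix-by-length : ∀ (p q r s : List A) → p ++ q ≡ r ++ s → length r ≤ length p → ∃ λ m → p ≡ r ++ m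
++-prefix-by-length p q r s eq |r|≤|p| with ++-overlap p q r s eq
... | inj₁ (m , p≡ , _)      = m , p≡
... | inj₂ ([] , r≡ , _)     = [] , trans (sym (++-identityʳ p)) (trans (sym r≡) (sym (++-identityʳ r)))
... | inj₂ (x ∷ m , refl , _) = ⊥-elim (<-irrefl refl (≤-trans (s≤s (m≤m+n (length p) (length m)))
    (≤-trans (≤-reflexive (trans (sym (+-suc (length p) (length m))) (sym (length-++ p)))) |r|≤|p|)))

⊑-image-of-two-letters : (ψ : List A → List A) → ψ [] ≡ [] → (∀ v w → ψ (v ++ w) ≡ ψ v ++ ψ w) →
  ∀ {w} → (∀ x → length w ≤ length (ψ [ x ])) → ∀ W → w ⊑ ψ W →
  ∃ λ s → s ⊑ W × length s ≤ 2 × w ⊑ ψ s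
⊑-image-of-two-letters ψ ψ-[] ψ-++ short [] w⊑ = [] , ⊑-refl [] , z≤n , w⊑
⊑-image-of-two-letters ψ ψ-[] ψ-++ {w} short (z ∷ W) (p , s , eq)
  with ++-overlap p (w ++ s) (ψ [ z ]) (ψ W) (trans eq (ψ-++ [ z ] W))
... | inj₁ (m , _ , eq′)
  with s′ , s′⊑W , |s′|≤2 , w⊑ ← ⊑-image-of-two-letters ψ ψ-[] ψ-++ short W (m , s , sym eq′) =
  s′ , ⊑-trans s′⊑W (⊑-∷ z W) , |s′|≤2 , w⊑
... | inj₂ (m , ψz≡ , eq′) with ++-overlap w s m (ψ W) eq′
...   | inj₂ (m′ , m≡ , _) = [ z ] , ([] , W , refl) , s≤s z≤n , (p , m′ , sym (trans ψz≡ (cong (p ++_) m≡)))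
...   | inj₁ (m′ , w≡ , eq″) with W
...     | [] = [ z ] , ([] , [] , refl) , s≤s z≤n , (p , [] , (begin
  p ++ w ++ []      ≡⟨ cong (p ++_) (++-identityʳ w) ⟩
  p ++ w            ≡⟨ cong (p ++_) w≡ ⟩
  p ++ m ++ m′      ≡⟨ cong (λ t → p ++ m ++ t) (++-conicalˡ m′ s (trans (sym eq″) ψ-[])) ⟩
  p ++ m ++ []      ≡⟨ cong (p ++_) (++-identityʳ m) ⟩
  p ++ m            ≡⟨ ψz≡ ⟨
  ψ [ z ]           ∎))
  where open ≡-Reasoning
...     | y ∷ W′ with m″ , ψy≡ ← ++-prefix-by-length (ψ [ y ]) (ψ W′) m′ s (trans (sym (ψ-++ [ y ] W′)) eq″)
                   (≤-trans (m≤n+m (length m′) (length m))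
                     (≤-trans (≤-reflexive (trans (sym (length-++ m)) (cong length (sym w≡)))) (short y))) =
  z ∷ y ∷ [] , ([] , W′ , refl) , s≤s (s≤s z≤n) , (p , m″ , (begin
  p ++ w ++ m″               ≡⟨ cong (λ t → p ++ t ++ m″) w≡ ⟩
  p ++ (m ++ m′) ++ m″       ≡⟨ solve 4 (λ P M M′ M″ → P ⊕ (M ⊕ M′) ⊕ M″ ⊜ (P ⊕ M) ⊕ (M′ ⊕ M″)) refl p m m′ m″ ⟩
  (p ++ m) ++ (m′ ++ m″)     ≡⟨ cong₂ _++_ ψz≡ ψy≡ ⟨
  ψ [ z ] ++ ψ [ y ]         ≡⟨ ψ-++ [ z ] [ y ] ⟨
  ψ (z ∷ y ∷ [])             ∎))
  where
  open ≡-Reasoning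
  open ++-Solver

module _ (_≟ₐ_ : DecidableEquality A) where

  prefix? : (w W : List A) → Dec (∃ λ s → w ++ s ≡ W)
  prefix? []      W       = yes (W , refl)
  prefix? (x ∷ w) []      = no λ { (s , ()) }
  prefix? (x ∷ w) (y ∷ W) with x ≟ₐ y | prefix? w W
  ... | yes refl | yes (s , eq) = yes (s , cong (x ∷_) eq)
  ... | yes refl | no ¬pre      = no λ { (s , eq) → ¬pre (s , ∷-injectiveʳ eq) }
  ... | no x≢y   | _            = no λ { (s , eq) → x≢y (∷-injectiveˡ eq) }

  _⊑?_ : (w W : List A) → Dec (w ⊑ W)
  []      ⊑? []      = yes ([] , [] , refl)
  (x ∷ w) ⊑? []      = no λ { (p , s , eq) → []≢++∷ p (sym eq) }
  w       ⊑? (y ∷ W) with prefix? w (y ∷ W) | w ⊑? W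
  ... | yes (s , eq) | _                 = yes ([] , s , eq)
  ... | no _         | yes (p , s , eq)  = yes (y ∷ p , s , cong (y ∷_) eq)
  ... | no ¬pre      | no ¬inner         = no λ
    { ([]    , s , eq) → ¬pre (s , eq)
    ; (z ∷ p , s , eq) → ¬inner (p , s , ∷-injectiveʳ eq) }

palindrome? : Decidable IsPalindrome
palindrome? w = ≡-dec _≟_ w (reverse w)

-- Factors of infinite words

at-++ : ∀ W t {i} → i < length W → at (W ++ t) i ≡ at W i
at-++ (x ∷ W) t {zero}  _         = refl
at-++ (x ∷ W) t {suc i} (s≤s i<n) = at-++ W t i<n

PrefixOf : Word → (ℕ → ℕ) → Set
PrefixOf W s = ∀ j → j < length W → s j ≡ at W j

PrefixOf-tail : ∀ {x W s} → PrefixOf (x ∷ W) s → PrefixOf W (s ∘ suc)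
PrefixOf-tail pre j j<n = pre (suc j) (s≤s j<n)

window-suc : ∀ s i n → window s (suc i) n ≡ window (s ∘ suc) i n
window-suc s i zero    = refl
window-suc s i (suc n) = cong (s (suc i) ∷_) (window-suc s (suc i) n)

window-prefix : ∀ {W s} n → PrefixOf W s → n ≤ length W → ∃ λ q → window s 0 n ++ q ≡ W
window-prefix {W}         zero    _   _         = W , refl
window-prefix {x ∷ W} {s} (suc n) pre (s≤s n≤) with q , eq ← window-prefix n (PrefixOf-tail pre) n≤ =
  q , trans (cong₂ (λ y v → y ∷ v ++ q) (pre 0 (s≤s z≤n)) (window-suc s 0 n)) (cong (x ∷_) eq)

window-⊑ : ∀ {W s} i n → PrefixOf W s → i + n ≤ length W → window s i n ⊑ W
window-⊑ zero n pre n≤ with q , eq ← window-prefix n pre n≤ = [] , q , eq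
window-⊑ {x ∷ W} {s} (suc i) n pre (s≤s i+n≤) =
  ⊑-trans (subst (_⊑ W) (sym (window-suc s i n)) (window-⊑ i n (PrefixOf-tail pre) i+n≤)) (⊑-∷ x W)

window-at-occurrence : ∀ {W s} p w q → PrefixOf W s → p ++ w ++ q ≡ W → window s (length p) (length w) ≡ w
window-at-occurrence {_ ∷ W} {s} (y ∷ p) w q pre refl =
  trans (window-suc s (length p) (length w)) (window-at-occurrence p w q (PrefixOf-tail pre) refl)
window-at-occurrence {W}     {s} []      [] q pre eq  = refl
window-at-occurrence {_ ∷ W} {s} []      (x ∷ w) q pre refl =
  cong₂ _∷_ (pre 0 (s≤s z≤n)) (trans (window-suc s 0 (length w)) (window-at-occurrence [] w q (PrefixOf-tail pre) refl))

-- Binary words, sums over them, and their enumeration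

Bit : ℕ → Set
Bit x = x ≡ 0 ⊎ x ≡ 1

Binary : Word → Set
Binary = All Bit

Bit-⊎ : {Q : ℕ → Set} → (∃ λ x → Bit x × Q x) → Q 0 ⊎ Q 1
Bit-⊎ (_ , inj₁ refl , q) = inj₁ q
Bit-⊎ (_ , inj₂ refl , q) = inj₂ q

𝟙 : Bool → ℕ
𝟙 true  = 1
𝟙 false = 0

sumWords : ℕ → (Word → ℕ) → ℕ
sumWords zero    f = f []
sumWords (suc n) f = sumWords n (f ∘ (0 ∷_)) + sumWords n (f ∘ (1 ∷_))

sumWords-cong : ∀ n {f g : Word → ℕ} → (∀ w → f w ≡ g w) → sumWords n f ≡ sumWords n g
sumWords-cong zero    f≗g = f≗g []
sumWords-cong (suc n) f≗g =
  cong₂ _+_ (sumWords-cong n (f≗g ∘ (0 ∷_))) (sumWords-cong n (f≗g ∘ (1 ∷_)))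

sumWords-+ : ∀ n (f g : Word → ℕ) → sumWords n (λ w → f w + g w) ≡ sumWords n f + sumWords n g
sumWords-+ zero    f g = refl
sumWords-+ (suc n) f g = trans
  (cong₂ _+_ (sumWords-+ n (f ∘ (0 ∷_)) (g ∘ (0 ∷_))) (sumWords-+ n (f ∘ (1 ∷_)) (g ∘ (1 ∷_))))
  (interchange (sumWords n (f ∘ (0 ∷_))) _ _ _)

sumWords-∷ʳ : ∀ n (f : Word → ℕ) → sumWords (suc n) f ≡ sumWords n (λ w → f (w ∷ʳ 0) + f (w ∷ʳ 1))
sumWords-∷ʳ zero    f = refl
sumWords-∷ʳ (suc n) f = cong₂ _+_ (sumWords-∷ʳ n (f ∘ (0 ∷_))) (sumWords-∷ʳ n (f ∘ (1 ∷_)))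

sumWords-∷-∷ʳ : ∀ n (f : Word → ℕ) → sumWords (suc (suc n)) f ≡
  sumWords n (λ w → (f (0 ∷ w ++ [ 0 ]) + f (0 ∷ w ++ [ 1 ])) + (f (1 ∷ w ++ [ 0 ]) + f (1 ∷ w ++ [ 1 ])))
sumWords-∷-∷ʳ n f = trans
  (cong₂ _+_ (sumWords-∷ʳ n (f ∘ (0 ∷_))) (sumWords-∷ʳ n (f ∘ (1 ∷_))))
  (sym (sumWords-+ n _ _))

enumerate : ℕ → (Word → Bool) → List Word
enumerate zero    p = if p [] then [ [] ] else []
enumerate (suc n) p = map (0 ∷_) (enumerate n (p ∘ (0 ∷_))) ++ map (1 ∷_) (enumerate n (p ∘ (1 ∷_)))

length-enumerate : ∀ n p → length (enumerate n p) ≡ sumWords n (𝟙 ∘ p)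
length-enumerate zero    p with p []
... | true  = refl
... | false = refl
length-enumerate (suc n) p = begin
  length (map (0 ∷_) E₀ ++ map (1 ∷_) E₁)         ≡⟨ length-++ (map (0 ∷_) E₀) ⟩
  length (map (0 ∷_) E₀) + length (map (1 ∷_) E₁) ≡⟨ cong₂ _+_ (length-map (0 ∷_) E₀) (length-map (1 ∷_) E₁) ⟩
  length E₀ + length E₁                           ≡⟨ cong₂ _+_ (length-enumerate n _) (length-enumerate n _) ⟩
  sumWords (suc n) (𝟙 ∘ p)                        ∎
  where
  open ≡-Reasoning
  E₀ E₁ : List Word
  E₀ = enumerate n (p ∘ (0 ∷_))
  E₁ = enumerate n (p ∘ (1 ∷_))

enumerate-unique : ∀ n p → Unique (enumerate n p)
enumerate-unique zero    p with p []
... | true  = [] ∷ []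
... | false = []
enumerate-unique (suc n) p = Unique.++⁺
  (Unique.map⁺ ∷-injectiveʳ (enumerate-unique n _))
  (Unique.map⁺ ∷-injectiveʳ (enumerate-unique n _))
  λ (∈₀ , ∈₁) → distinct-heads (∈.∈-map⁻ (0 ∷_) ∈₀) (∈.∈-map⁻ (1 ∷_) ∈₁)
  where
  distinct-heads : ∀ {v : Word} {E₀ E₁ : List Word} → (∃ λ w → w ∈ E₀ × v ≡ 0 ∷ w) → ¬ (∃ λ w → w ∈ E₁ × v ≡ 1 ∷ w)
  distinct-heads (_ , _ , refl) (_ , _ , ())

∈-enumerate⁻ : ∀ n p {w} → w ∈ enumerate n p → length w ≡ n × p w ≡ true
∈-enumerate⁻ zero    p w∈ with p [] in p[]
∈-enumerate⁻ zero    p (here refl) | true = refl , p[]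
∈-enumerate⁻ (suc n) p w∈ with ∈.∈-++⁻ (map (0 ∷_) (enumerate n (p ∘ (0 ∷_)))) w∈
... | inj₁ w∈₀ with _ , v∈ , refl ← ∈.∈-map⁻ (0 ∷_) w∈₀ =
  let |v| , pv = ∈-enumerate⁻ n _ v∈ in cong suc |v| , pv
... | inj₂ w∈₁ with _ , v∈ , refl ← ∈.∈-map⁻ (1 ∷_) w∈₁ =
  let |v| , pv = ∈-enumerate⁻ n _ v∈ in cong suc |v| , pv

∈-enumerate⁺ : ∀ n p {w} → length w ≡ n → Binary w → p w ≡ true → w ∈ enumerate n p
∈-enumerate⁺ zero    p {[]}    refl _ pw rewrite pw = here refl
∈-enumerate⁺ (suc n) p {x ∷ w} refl (inj₁ refl ∷ bin) pw =
  ∈.∈-++⁺ˡ (∈.∈-map⁺ (0 ∷_) (∈-enumerate⁺ n _ refl bin pw))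
∈-enumerate⁺ (suc n) p {x ∷ w} refl (inj₂ refl ∷ bin) pw =
  ∈.∈-++⁺ʳ (map (0 ∷_) (enumerate n (p ∘ (0 ∷_)))) (∈.∈-map⁺ (1 ∷_) (∈-enumerate⁺ n _ refl bin pw))

sumWords-HasCard : ∀ n {Q R : Word → Set} (Q? : Decidable Q) → (∀ {w} → Q w → Binary w) →
  (∀ {w} → R w ⇔ Q w) → HasCard (λ w → length w ≡ n × R w) (sumWords n (λ w → 𝟙 (does (Q? w))))
sumWords-HasCard n Q? Q⇒Binary R⇔Q = enumerate n p , enumerate-unique n p , length-enumerate n p ,
  λ w → mk⇔ (λ w∈ → let |w| , pw = ∈-enumerate⁻ n p w∈ in |w| , from R⇔Q (dec-true⁻¹ (Q? w) pw))
            (λ (|w| , Rw) → let Qw = to R⇔Q Rw in ∈-enumerate⁺ n p |w| (Q⇒Binary Qw) (dec-true (Q? w) Qw))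
  where
  open Equivalence
  p : Word → Bool
  p w = does (Q? w)

-- Palindromic complexity of a language closed under reversal

module _ (L : Word → Set) where

  Bispecial : Word → Set
  Bispecial w = L (0 ∷ w) × L (1 ∷ w) × L (w ++ [ 0 ]) × L (w ++ [ 1 ])

  -- The only extension pattern of a palindromic bispecial factor that breaks local-identity below.
  WeakSymmetric : Word → Set
  WeakSymmetric w = L (0 ∷ w ++ [ 0 ]) × L (1 ∷ w ++ [ 1 ]) × ¬ L (0 ∷ w ++ [ 1 ]) × ¬ L (1 ∷ w ++ [ 0 ])

-- The Boolean core of local-identity below, eˣʸ being the indicator of the two-sided extension xwy.
nonpalindromic-balance : ∀ e₀₀ e₀₁ e₁₀ e₁₁ →
  ¬ (e₀₀ ∨ e₀₁ ≡ true × e₁₀ ∨ e₁₁ ≡ true × e₀₀ ∨ e₁₀ ≡ true × e₀₁ ∨ e₁₁ ≡ true) →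
  (𝟙 e₀₀ + 𝟙 e₀₁) + (𝟙 e₁₀ + 𝟙 e₁₁) + 𝟙 ((e₀₀ ∨ e₀₁) ∨ (e₁₀ ∨ e₁₁)) + 0
    ≡ (𝟙 (e₀₀ ∨ e₀₁) + 𝟙 (e₁₀ ∨ e₁₁)) + (𝟙 (e₀₀ ∨ e₁₀) + 𝟙 (e₀₁ ∨ e₁₁)) + (0 + 0)
nonpalindromic-balance true  true  true  true  ¬bisp = ⊥-elim (¬bisp (refl , refl , refl , refl))
nonpalindromic-balance true  true  true  false ¬bisp = ⊥-elim (¬bisp (refl , refl , refl , refl))
nonpalindromic-balance true  true  false true  ¬bisp = ⊥-elim (¬bisp (refl , refl , refl , refl))
nonpalindromic-balance true  true  false false _     = refl
nonpalindromic-balance true  false true  true  ¬bisp = ⊥-elim (¬bisp (refl , refl , refl , refl))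
nonpalindromic-balance true  false true  false _     = refl
nonpalindromic-balance true  false false true  ¬bisp = ⊥-elim (¬bisp (refl , refl , refl , refl))
nonpalindromic-balance true  false false false _     = refl
nonpalindromic-balance false true  true  true  ¬bisp = ⊥-elim (¬bisp (refl , refl , refl , refl))
nonpalindromic-balance false true  true  false ¬bisp = ⊥-elim (¬bisp (refl , refl , refl , refl))
nonpalindromic-balance false true  false true  _     = refl
nonpalindromic-balance false true  false false _     = refl
nonpalindromic-balance false false true  true  _     = refl
nonpalindromic-balance false false true  false _     = refl
nonpalindromic-balance false false false true  _     = refl
nonpalindromic-balance false false false false _     = refl

palindromic-balance : ∀ e₀₀ e₀₁ e₁₁ → ¬ (e₀₀ ≡ true × e₁₁ ≡ true × e₀₁ ≡ false) →
  (𝟙 e₀₀ + 𝟙 e₀₁) + (𝟙 e₀₁ + 𝟙 e₁₁) + 𝟙 ((e₀₀ ∨ e₀₁) ∨ (e₀₁ ∨ e₁₁)) + 𝟙 ((e₀₀ ∨ e₀₁) ∨ (e₀₁ ∨ e₁₁))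
    ≡ (𝟙 (e₀₀ ∨ e₀₁) + 𝟙 (e₀₁ ∨ e₁₁)) + (𝟙 (e₀₀ ∨ e₀₁) + 𝟙 (e₀₁ ∨ e₁₁)) + (𝟙 e₀₀ + 𝟙 e₁₁)
palindromic-balance true  true  true  _     = refl
palindromic-balance true  true  false _     = refl
palindromic-balance true  false true  ¬weak = ⊥-elim (¬weak (refl , refl , refl))
palindromic-balance true  false false _     = refl
palindromic-balance false true  true  _     = refl
palindromic-balance false true  false _     = refl
palindromic-balance false false true  _     = refl
palindromic-balance false false false _     = refl

-- The recurrence says that P (n + 1) + P n + C n − C (n + 1) does not depend on n.
recurrence-invariant : (C P : ℕ → ℕ) → P 1 + P 0 + C 0 ≡ C 1 + 2 →
  (∀ n → C (2 + n) + C n + P n ≡ C (1 + n) + C (1 + n) + P (2 + n)) →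
  ∀ n → P (1 + n) + P n + C n ≡ C (1 + n) + 2
recurrence-invariant C P base step zero    = base
recurrence-invariant C P base step (suc n) = +-cancelʳ-≡ (C n + P n) _ _ (begin
  (P₂ + P₁ + C₁) + (C₀ + P₀)   ≡⟨ shuffle₁ P₂ P₁ C₁ C₀ P₀ ⟩
  (P₁ + P₀ + C₀) + (P₂ + C₁)   ≡⟨ cong (_+ (P₂ + C₁)) (recurrence-invariant C P base step n) ⟩
  (C₁ + 2) + (P₂ + C₁)         ≡⟨ shuffle₂ C₁ P₂ ⟩
  (C₁ + C₁ + P₂) + 2           ≡⟨ cong (_+ 2) (step n) ⟨
  (C₂ + C₀ + P₀) + 2           ≡⟨ shuffle₃ C₂ C₀ P₀ ⟩
  (C₂ + 2) + (C₀ + P₀)         ∎)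
  where
  open ≡-Reasoning
  open Data.Nat.Solver.+-*-Solver using (solve; _:=_; _:+_; con)
  C₀ C₁ C₂ P₀ P₁ P₂ : ℕ
  C₀ = C n
  C₁ = C (1 + n)
  C₂ = C (2 + n)
  P₀ = P n
  P₁ = P (1 + n)
  P₂ = P (2 + n)
  shuffle₁ : ∀ p₂ p₁ c₁ c₀ p₀ → (p₂ + p₁ + c₁) + (c₀ + p₀) ≡ (p₁ + p₀ + c₀) + (p₂ + c₁)
  shuffle₁ = solve 5 (λ p₂ p₁ c₁ c₀ p₀ → (p₂ :+ p₁ :+ c₁) :+ (c₀ :+ p₀) := (p₁ :+ p₀ :+ c₀) :+ (p₂ :+ c₁)) refl
  shuffle₂ : ∀ c₁ p₂ → (c₁ + 2) + (p₂ + c₁) ≡ (c₁ + c₁ + p₂) + 2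
  shuffle₂ = solve 2 (λ c₁ p₂ → (c₁ :+ con 2) :+ (p₂ :+ c₁) := (c₁ :+ c₁ :+ p₂) :+ con 2) refl
  shuffle₃ : ∀ c₂ c₀ p₀ → (c₂ + c₀ + p₀) + 2 ≡ (c₂ + 2) + (c₀ + p₀)
  shuffle₃ = solve 3 (λ c₂ c₀ p₀ → (c₂ :+ c₀ :+ p₀) :+ con 2 := (c₂ :+ con 2) :+ (c₀ :+ p₀)) refl

module PalindromicComplexity
  (L : Word → Set) (L? : Decidable L)
  (L-tail : ∀ {x w} → L (x ∷ w) → L w)
  (L-init : ∀ {w y} → L (w ++ [ y ]) → L w)
  (extendˡ : ∀ {w} → L w → ∃ λ x → Bit x × L (x ∷ w))
  (extendʳ : ∀ {w} → L w → ∃ λ y → Bit y × L (w ++ [ y ]))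
  (L-reverse : ∀ {w} → L w → L (reverse w))
  (bispecial-good : ∀ {w} → Bispecial L w → IsPalindrome w × ¬ WeakSymmetric L w)
  (L-0 : L [ 0 ]) (L-1 : L [ 1 ])
  where

  PalL : Word → Set
  PalL w = L w × IsPalindrome w

  PalL? : Decidable PalL
  PalL? w = L? w ×-dec palindrome? w

  ℓ π : Word → Bool
  ℓ w = does (L? w)
  π w = does (PalL? w)

  C P : ℕ → ℕ
  C n = sumWords n (𝟙 ∘ ℓ)
  P n = sumWords n (𝟙 ∘ π)

  ℓ-extendˡ : ∀ w → ℓ w ≡ ℓ (0 ∷ w) ∨ ℓ (1 ∷ w)
  ℓ-extendˡ w = does-⇔ (mk⇔ (Bit-⊎ ∘ extendˡ) [ L-tail , L-tail ]′) (L? _) (L? _ ⊎-dec L? _)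

  ℓ-∷-extendʳ : ∀ x w → ℓ (x ∷ w) ≡ ℓ (x ∷ w ++ [ 0 ]) ∨ ℓ (x ∷ w ++ [ 1 ])
  ℓ-∷-extendʳ x w = does-⇔ (mk⇔ (Bit-⊎ ∘ extendʳ) [ L-init , L-init ]′) (L? _) (L? _ ⊎-dec L? _)

  ℓ-∷ʳ-extendˡ : ∀ w y → ℓ (w ++ [ y ]) ≡ ℓ (0 ∷ w ++ [ y ]) ∨ ℓ (1 ∷ w ++ [ y ])
  ℓ-∷ʳ-extendˡ w y = does-⇔ (mk⇔ (Bit-⊎ ∘ extendˡ) [ L-tail , L-tail ]′) (L? _) (L? _ ⊎-dec L? _)

  ℓ-swap : ∀ {w} → IsPalindrome w → ℓ (1 ∷ w ++ [ 0 ]) ≡ ℓ (0 ∷ w ++ [ 1 ])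
  ℓ-swap {w} pal = does-⇔ (mk⇔ swap swap) (L? _) (L? _)
    where
    swap : ∀ {x y} → L (x ∷ w ++ [ y ]) → L (y ∷ w ++ [ x ])
    swap {x} {y} Lxwy = subst L (trans (reverse-∷-∷ʳ x w y) (cong (λ v → y ∷ v ++ [ x ]) (sym pal))) (L-reverse Lxwy)

  π-palindrome : ∀ {w} → IsPalindrome w → π w ≡ ℓ w
  π-palindrome pal = does-⇔ (mk⇔ proj₁ (_, pal)) (PalL? _) (L? _)

  π-∷-∷ʳ : ∀ x {w} → IsPalindrome w → π (x ∷ w ++ [ x ]) ≡ ℓ (x ∷ w ++ [ x ])
  π-∷-∷ʳ x {w} pal = π-palindrome (sym (trans (reverse-∷-∷ʳ x w x) (cong (λ v → x ∷ v ++ [ x ]) (sym pal))))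

  π-nonpalindrome : ∀ {w} → ¬ IsPalindrome w → π w ≡ false
  π-nonpalindrome ¬pal = dec-false (PalL? _) (¬pal ∘ proj₂)

  π-∷-∷ʳ-nonpalindrome : ∀ x {w} → ¬ IsPalindrome w → π (x ∷ w ++ [ x ]) ≡ false
  π-∷-∷ʳ-nonpalindrome x {w} ¬pal = π-nonpalindrome λ pal →
    ¬pal (∷ʳ-injectiveˡ w (reverse w) (∷-injectiveʳ (trans pal (reverse-∷-∷ʳ x w x))))

  π-unequal-ends : ∀ w → π (0 ∷ w ++ [ 1 ]) ≡ false × π (1 ∷ w ++ [ 0 ]) ≡ false
  π-unequal-ends w = unequal (λ ()) , unequal (λ ())
    where
    unequal : ∀ {x y} → x ≢ y → π (x ∷ w ++ [ y ]) ≡ false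
    unequal {x} {y} x≢y = π-nonpalindrome λ pal → x≢y (∷-injectiveˡ (trans pal (reverse-∷-∷ʳ x w y)))

  twoSided leftExt rightExt palExt : Word → ℕ
  twoSided w = (𝟙 (ℓ (0 ∷ w ++ [ 0 ])) + 𝟙 (ℓ (0 ∷ w ++ [ 1 ]))) + (𝟙 (ℓ (1 ∷ w ++ [ 0 ])) + 𝟙 (ℓ (1 ∷ w ++ [ 1 ])))
  leftExt  w = 𝟙 (ℓ (0 ∷ w)) + 𝟙 (ℓ (1 ∷ w))
  rightExt w = 𝟙 (ℓ (w ++ [ 0 ])) + 𝟙 (ℓ (w ++ [ 1 ]))
  palExt   w = 𝟙 (π (0 ∷ w ++ [ 0 ])) + 𝟙 (π (1 ∷ w ++ [ 1 ]))

  local-identity : ∀ w → twoSided w + 𝟙 (ℓ w) + 𝟙 (π w) ≡ leftExt w + rightExt w + palExt w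
  local-identity w = by-palindromicity (palindrome? w)
    where
    e : ℕ → ℕ → Bool
    e x y = ℓ (x ∷ w ++ [ y ])

    from : ∀ {v} → ℓ v ≡ true → L v
    from = dec-true⁻¹ (L? _)

    by-palindromicity : Dec (IsPalindrome w) → twoSided w + 𝟙 (ℓ w) + 𝟙 (π w) ≡ leftExt w + rightExt w + palExt w
    by-palindromicity (yes pal)
      rewrite π-palindrome pal | π-∷-∷ʳ 0 pal | π-∷-∷ʳ 1 pal
            | ℓ-extendˡ w | ℓ-∷-extendʳ 0 w | ℓ-∷-extendʳ 1 w | ℓ-∷ʳ-extendˡ w 0 | ℓ-∷ʳ-extendˡ w 1 | ℓ-swap pal
      = palindromic-balance (e 0 0) (e 0 1) (e 1 1) λ (e₀₀ , e₁₁ , e₀₁) →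
          proj₂ (bispecial-good (L-init (from e₀₀) , L-init (from e₁₁) , L-tail (from e₀₀) , L-tail (from e₁₁)))
            (from e₀₀ , from e₁₁ , dec-false⁻¹ (L? _) e₀₁ , dec-false⁻¹ (L? _) (trans (ℓ-swap pal) e₀₁))
    by-palindromicity (no ¬pal)
      rewrite π-nonpalindrome ¬pal | π-∷-∷ʳ-nonpalindrome 0 ¬pal | π-∷-∷ʳ-nonpalindrome 1 ¬pal
            | ℓ-extendˡ w | ℓ-∷-extendʳ 0 w | ℓ-∷-extendʳ 1 w | ℓ-∷ʳ-extendˡ w 0 | ℓ-∷ʳ-extendˡ w 1
      = nonpalindromic-balance (e 0 0) (e 0 1) (e 1 0) (e 1 1) λ (l₀ , l₁ , r₀ , r₁) → ¬pal (proj₁ (bispecial-good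
          (from (trans (ℓ-∷-extendʳ 0 w) l₀) , from (trans (ℓ-∷-extendʳ 1 w) l₁) , from (trans (ℓ-∷ʳ-extendˡ w 0) r₀) , from (trans (ℓ-∷ʳ-extendˡ w 1) r₁))))

  palExt-sum : ∀ n → sumWords n palExt ≡ P (2 + n)
  palExt-sum n = sym (trans (sumWords-∷-∷ʳ n (𝟙 ∘ π)) (sumWords-cong n drop-unequal-ends))
    where
    drop-unequal-ends : ∀ w → (𝟙 (π (0 ∷ w ++ [ 0 ])) + 𝟙 (π (0 ∷ w ++ [ 1 ]))) + (𝟙 (π (1 ∷ w ++ [ 0 ])) + 𝟙 (π (1 ∷ w ++ [ 1 ])))
                              ≡ palExt w
    drop-unequal-ends w rewrite proj₁ (π-unequal-ends w) | proj₂ (π-unequal-ends w) =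
      cong (_+ 𝟙 (π (1 ∷ w ++ [ 1 ]))) (+-identityʳ (𝟙 (π (0 ∷ w ++ [ 0 ]))))

  C-P-recurrence : ∀ n → C (2 + n) + C n + P n ≡ C (1 + n) + C (1 + n) + P (2 + n)
  C-P-recurrence n = begin
    C (2 + n) + C n + P n
      ≡⟨ cong (λ c → c + C n + P n) (sumWords-∷-∷ʳ n (𝟙 ∘ ℓ)) ⟩
    sumWords n twoSided + C n + P n
      ≡⟨ trans (sumWords-+ n _ _) (cong (_+ P n) (sumWords-+ n _ _)) ⟨
    sumWords n (λ w → twoSided w + 𝟙 (ℓ w) + 𝟙 (π w))
      ≡⟨ sumWords-cong n local-identity ⟩
    sumWords n (λ w → leftExt w + rightExt w + palExt w)
      ≡⟨ trans (sumWords-+ n _ _) (cong (_+ sumWords n palExt) (sumWords-+ n _ _)) ⟩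
    sumWords n leftExt + sumWords n rightExt + sumWords n palExt
      ≡⟨ cong₂ _+_ (cong₂ _+_ (sumWords-+ n _ _) (sym (sumWords-∷ʳ n (𝟙 ∘ ℓ)))) (palExt-sum n) ⟩
    C (1 + n) + C (1 + n) + P (2 + n) ∎
    where open ≡-Reasoning

  palindromic-complexity : ∀ n → P (1 + n) + P n + C n ≡ C (1 + n) + 2
  palindromic-complexity = recurrence-invariant C P base C-P-recurrence
    where
    base : P 1 + P 0 + C 0 ≡ C 1 + 2
    base rewrite π-palindrome {[ 0 ]} refl | π-palindrome {[ 1 ]} refl | π-palindrome {[]} refl
               | dec-true (L? []) (L-tail L-0) | dec-true (L? [ 0 ]) L-0 | dec-true (L? [ 1 ]) L-1 = refl

-- The language of u_β

-- a is written as e + b + 2 so that φ(0) = 0 ∷ 0 ∷ ⋯ holds by computation.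
module FixedPoint (b e : ℕ) (b≥1 : 1 ≤ b) where

  open ≡-Reasoning
  open Algebra.Solver.Monoid (++-monoid ℕ) using (solve; _⊜_; _⊕_) renaming (id to ε)

  a : ℕ
  a = suc (suc (e + b))

  zeros : ℕ → Word
  zeros n = replicate n 0

  B : Word
  B = zeros b

  run : ℕ → ℕ
  run zero    = a
  run (suc _) = b

  ϕ : ℕ → Word
  ϕ = φ a b

  ϕ* : Word → Word
  ϕ* = φ* a b

  U : ℕ → Word
  U k = iter a b k [ 0 ]

  ϕ-run : ∀ x → ϕ x ≡ zeros (run x) ++ [ 1 ]
  ϕ-run zero    = refl
  ϕ-run (suc x) = refl

  ϕ-run-++ : ∀ x X → ϕ x ++ X ≡ zeros (run x) ++ 1 ∷ X
  ϕ-run-++ x X = trans (cong (_++ X) (ϕ-run x)) (++-assoc (zeros (run x)) [ 1 ] X)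

  ϕ*-++ : ∀ v w → ϕ* (v ++ w) ≡ ϕ* v ++ ϕ* w
  ϕ*-++ []      w = refl
  ϕ*-++ (x ∷ v) w = trans (cong (ϕ x ++_) (ϕ*-++ v w)) (sym (++-assoc (ϕ x) (ϕ* v) (ϕ* w)))

  iter-++ : ∀ k v w → iter a b k (v ++ w) ≡ iter a b k v ++ iter a b k w
  iter-++ zero    v w = refl
  iter-++ (suc k) v w = trans (cong ϕ* (iter-++ k v w)) (ϕ*-++ (iter a b k v) (iter a b k w))

  iter-[] : ∀ k → iter a b k [] ≡ []
  iter-[] zero    = refl
  iter-[] (suc k) = cong ϕ* (iter-[] k)

  iter-ϕ* : ∀ k w → iter a b k (ϕ* w) ≡ ϕ* (iter a b k w)
  iter-ϕ* zero    w = refl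
  iter-ϕ* (suc k) w = cong ϕ* (iter-ϕ* k w)

  iter-+ : ∀ j k w → iter a b (j + k) w ≡ iter a b j (iter a b k w)
  iter-+ zero    k w = refl
  iter-+ (suc j) k w = cong ϕ* (iter-+ j k w)

  a≡b+2+e : a ≡ b + suc (suc e)
  a≡b+2+e = trans (cong (suc ∘ suc) (+-comm e b)) (sym (trans (+-suc b (suc e)) (cong suc (+-suc b e))))

  zeros-a-left : zeros a ≡ B ++ 0 ∷ zeros (suc e)
  zeros-a-left = trans (cong zeros a≡b+2+e) (replicate-+ b (suc (suc e)) 0)

  zeros-a-right : zeros a ≡ zeros (suc e) ++ 0 ∷ B
  zeros-a-right = trans (cong zeros (cong suc (sym (+-suc e b)))) (replicate-+ (suc e) (suc b) 0)

  b<a : b < a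
  b<a = s≤s (≤-trans (n≤1+n b) (s≤s (m≤n+m b e)))

  run≤a : ∀ x → run x ≤ a
  run≤a zero    = ≤-refl
  run≤a (suc x) = <⇒≤ b<a

  run≥1 : ∀ x → 1 ≤ run x
  run≥1 zero    = s≤s z≤n
  run≥1 (suc x) = b≥1

  run-injective : ∀ {x y} → Bit x → Bit y → run x ≡ run y → x ≡ y
  run-injective (inj₁ refl) (inj₁ refl) _   = refl
  run-injective (inj₁ refl) (inj₂ refl) a≡b = ⊥-elim (<-irrefl (sym a≡b) b<a)
  run-injective (inj₂ refl) (inj₁ refl) b≡a = ⊥-elim (<-irrefl b≡a b<a)
  run-injective (inj₂ refl) (inj₂ refl) _   = refl

  U-suc : ∀ k → ∃ λ R → U (suc k) ≡ U k ++ U k ++ R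
  U-suc k = iter a b k R , (begin
    ϕ* (U k)                              ≡⟨ iter-ϕ* k [ 0 ] ⟨
    iter a b k ([ 0 ] ++ [ 0 ] ++ R)      ≡⟨ iter-++ k [ 0 ] ([ 0 ] ++ R) ⟩
    U k ++ iter a b k ([ 0 ] ++ R)        ≡⟨ cong (U k ++_) (iter-++ k [ 0 ] R) ⟩
    U k ++ U k ++ iter a b k R            ∎)
    where
    R : Word
    R = (zeros (e + b) ++ [ 1 ]) ++ []

  U-head : ∀ k → ∃ λ t → U k ≡ 0 ∷ t
  U-head zero    = [] , refl
  U-head (suc k) with t , eq ← U-head k = _ , cong ϕ* eq

  U-prefix : ∀ j k → ∃ λ t → U k ++ t ≡ U (j + k)
  U-prefix zero    k = [] , ++-identityʳ (U k)
  U-prefix (suc j) k with t , eq ← U-prefix j k | R , eqR ← U-suc (j + k) =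
    t ++ U (j + k) ++ R , trans (sym (++-assoc (U k) t _)) (trans (cong (_++ _) eq) (sym eqR))

  ⊑-U : ∀ {w} j k → w ⊑ U k → w ⊑ U (j + k)
  ⊑-U j k w⊑ with t , eq ← U-prefix j k = ⊑-trans w⊑ ([] , t , eq)

  Binary-ϕ : ∀ x → Binary (ϕ x)
  Binary-ϕ x rewrite ϕ-run x = All.++⁺ (All.replicate⁺ (run x) (inj₁ refl)) (inj₂ refl ∷ [])

  Binary-ϕ* : ∀ v → Binary (ϕ* v)
  Binary-ϕ* []      = []
  Binary-ϕ* (x ∷ v) = All.++⁺ (Binary-ϕ x) (Binary-ϕ* v)

  Binary-U : ∀ k → Binary (U k)
  Binary-U zero    = inj₁ refl ∷ []
  Binary-U (suc k) = Binary-ϕ* (U k)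

  ⊑-ϕ* : ∀ {w W} → w ⊑ W → ϕ* w ⊑ ϕ* W
  ⊑-ϕ* = ⊑-homomorphism ϕ* ϕ*-++

  ⊑-iter : ∀ k {w W} → w ⊑ W → iter a b k w ⊑ iter a b k W
  ⊑-iter k = ⊑-homomorphism (iter a b k) (iter-++ k)

  length-ϕ : ∀ x → 2 ≤ length (ϕ x)
  length-ϕ x rewrite ϕ-run x | length-++ (zeros (run x)) {[ 1 ]} | length-replicate (run x) {0} =
    ≤-trans (s≤s (run≥1 x)) (≤-reflexive (+-comm 1 (run x)))

  length-ϕ* : ∀ v → length v + length v ≤ length (ϕ* v)
  length-ϕ* []      = z≤n
  length-ϕ* (x ∷ v) rewrite length-++ (ϕ x) {ϕ* v} =
    ≤-trans (≤-reflexive (cong suc (+-suc (length v) (length v)))) (+-mono-≤ (length-ϕ x) (length-ϕ* v))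

  length-iter : ∀ k x → suc k ≤ length (iter a b k [ x ])
  length-iter zero    x = ≤-refl
  length-iter (suc k) x = ≤-trans (s≤s (m≤n+m (suc k) k))
    (≤-trans (+-mono-≤ (length-iter k x) (length-iter k x)) (length-ϕ* (iter a b k [ x ])))

  Factor : Word → Set
  Factor w = ∃ λ k → w ⊑ U k

  Factor-⊑ : ∀ {w W} → w ⊑ W → Factor W → Factor w
  Factor-⊑ w⊑W (k , W⊑U) = k , ⊑-trans w⊑W W⊑U

  Factor-tail : ∀ {x w} → Factor (x ∷ w) → Factor w
  Factor-tail = Factor-⊑ (⊑-∷ _ _)

  Factor-init : ∀ {w y} → Factor (w ++ [ y ]) → Factor w
  Factor-init = Factor-⊑ (⊑-∷ʳ _ _)

  Factor-ϕ* : ∀ {w} → Factor w → ∃ λ k → w ⊑ ϕ* (U k)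
  Factor-ϕ* (k , w⊑U) = k , ⊑-U 1 k w⊑U

  Factor-binary : ∀ {w} → Factor w → Binary w
  Factor-binary (k , w⊑U) = All-⊑ w⊑U (Binary-U k)

  -- U (k + 1) begins with U k U k and U k begins with 0, so an occurrence in U k is followed, and
  -- its copy in the second U k is preceded, by a letter.
  extendʳ : ∀ {w} → Factor w → ∃ λ y → Bit y × Factor (w ++ [ y ])
  extendʳ {w} (k , p , s , eq) with R , eqR ← U-suc k | t , eqt ← U-head k
    with y , s′ , eqs ← ++-∷-view s 0 (t ++ R) = y , head (All.++⁻ʳ w (Factor-binary wy)) , wy
    where
    wy : Factor (w ++ [ y ])
    wy = suc k , p , s′ , (begin
      p ++ (w ++ [ y ]) ++ s′       ≡⟨ solve 4 (λ P W Y S → P ⊕ (W ⊕ Y) ⊕ S ⊜ P ⊕ W ⊕ (Y ⊕ S)) refl p w [ y ] s′ ⟩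
      p ++ w ++ y ∷ s′              ≡⟨ cong (λ v → p ++ w ++ v) eqs ⟨
      p ++ w ++ s ++ 0 ∷ t ++ R     ≡⟨ solve 4 (λ P W S V → P ⊕ W ⊕ S ⊕ V ⊜ (P ⊕ W ⊕ S) ⊕ V) refl p w s (0 ∷ t ++ R) ⟩
      (p ++ w ++ s) ++ 0 ∷ t ++ R   ≡⟨ cong₂ (λ u v → u ++ v ++ R) eq (sym eqt) ⟩
      U k ++ U k ++ R               ≡⟨ eqR ⟨
      U (suc k)                     ∎)

  extendˡ : ∀ {w} → Factor w → ∃ λ x → Bit x × Factor (x ∷ w)
  extendˡ {w} (k , p , s , eq) with R , eqR ← U-suc k | t , eqt ← U-head k
    with q , x , eqq ← ∷-∷ʳ-view 0 (t ++ p) = x , head (Factor-binary xw) , xw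
    where
    xw : Factor (x ∷ w)
    xw = suc k , q , s ++ R , (begin
      q ++ (x ∷ w) ++ s ++ R          ≡⟨ solve 5 (λ Q X W S R → Q ⊕ (X ⊕ W) ⊕ S ⊕ R ⊜ (Q ⊕ X) ⊕ W ⊕ S ⊕ R) refl q [ x ] w s R ⟩
      (q ++ [ x ]) ++ w ++ s ++ R     ≡⟨ cong (λ v → v ++ w ++ s ++ R) eqq ⟨
      (0 ∷ t ++ p) ++ w ++ s ++ R     ≡⟨ solve 5 (λ T P W S R → (T ⊕ P) ⊕ W ⊕ S ⊕ R ⊜ T ⊕ (P ⊕ W ⊕ S) ⊕ R) refl (0 ∷ t) p w s R ⟩
      (0 ∷ t) ++ (p ++ w ++ s) ++ R   ≡⟨ cong₂ (λ u v → u ++ v ++ R) (sym eqt) eq ⟩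
      U k ++ U k ++ R                 ≡⟨ eqR ⟨
      U (suc k)                       ∎)

  zeros-1-split : ∀ n P X S → zeros n ++ 1 ∷ X ≡ P ++ 1 ∷ S →
    (P ≡ zeros n × X ≡ S) ⊎ (∃ λ P′ → P ≡ zeros n ++ 1 ∷ P′ × X ≡ P′ ++ 1 ∷ S)
  zeros-1-split zero    []      X S eq = inj₁ (refl , ∷-injectiveʳ eq)
  zeros-1-split zero    (p ∷ P) X S eq with refl , eq′ ← ∷-injective eq = inj₂ (P , refl , eq′)
  zeros-1-split (suc n) (p ∷ P) X S eq with refl , eq′ ← ∷-injective eq with zeros-1-split n P X S eq′
  ... | inj₁ (P≡ , X≡)      = inj₁ (cong (0 ∷_) P≡ , X≡)
  ... | inj₂ (P′ , P≡ , X≡) = inj₂ (P′ , cong (0 ∷_) P≡ , X≡)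

  zeros-1-injective : ∀ m n X Y → zeros m ++ 1 ∷ X ≡ zeros n ++ 1 ∷ Y → m ≡ n × X ≡ Y
  zeros-1-injective zero    zero    X Y eq = refl , ∷-injectiveʳ eq
  zeros-1-injective (suc m) (suc n) X Y eq with refl , X≡Y ← zeros-1-injective m n X Y (∷-injectiveʳ eq) = refl , X≡Y

  zeros-prefix : ∀ m n X y Y → zeros (m + suc n) ++ X ≡ zeros m ++ y ∷ Y → y ≡ 0
  zeros-prefix zero    n X y Y eq = sym (∷-injectiveˡ eq)
  zeros-prefix (suc m) n X y Y eq = zeros-prefix m n X y Y (∷-injectiveʳ eq)

  zeros-a-after-b : ∀ X y Y → zeros a ++ X ≡ B ++ y ∷ Y → y ≡ 0
  zeros-a-after-b X y Y eq = zeros-prefix b (suc e) X y Y (trans (cong (λ n → zeros n ++ X) (sym a≡b+2+e)) eq)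

  ϕ*-split-at-1 : ∀ W P S → P ++ 1 ∷ S ≡ ϕ* W →
    ∃₂ λ W₁ W₂ → W ≡ W₁ ++ W₂ × ϕ* W₁ ≡ P ++ [ 1 ] × ϕ* W₂ ≡ S
  ϕ*-split-at-1 []      P S eq = ⊥-elim ([]≢++∷ P (sym eq))
  ϕ*-split-at-1 (z ∷ W) P S eq with zeros-1-split (run z) P (ϕ* W) S (sym (trans eq (ϕ-run-++ z (ϕ* W))))
  ... | inj₁ (refl , refl) = [ z ] , W , refl , trans (++-identityʳ (ϕ z)) (ϕ-run z) , refl
  ... | inj₂ (P′ , refl , eq′) with W₁ , W₂ , refl , ϕW₁ , ϕW₂ ← ϕ*-split-at-1 W P′ S (sym eq′) =
    z ∷ W₁ , W₂ , refl ,
    trans (ϕ-run-++ z (ϕ* W₁)) (trans (cong (λ v → zeros (run z) ++ 1 ∷ v) ϕW₁)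
      (sym (++-assoc (zeros (run z)) (1 ∷ P′) [ 1 ]))) ,
    ϕW₂

  -- ϕ(0) begins with 0ᵇ0 and ϕ(1) = 0ᵇ1, so 0ᵇy after a ϕ*-image can only start ϕ(y).
  ϕ*-prefix⁻¹ : ∀ {v W y} s → Binary v → Binary W → Bit y → ϕ* W ≡ ϕ* v ++ B ++ y ∷ s →
    ∃ λ W′ → W ≡ v ++ y ∷ W′
  ϕ*-prefix⁻¹ {[]} {[]} s _ _ _ eq = ⊥-elim ([]≢++∷ B eq)
  ϕ*-prefix⁻¹ {[]} {z ∷ W} s _ (inj₁ refl ∷ _) (inj₁ refl) eq = W , refl
  ϕ*-prefix⁻¹ {[]} {z ∷ W} s _ (inj₂ refl ∷ _) (inj₂ refl) eq = W , refl
  ϕ*-prefix⁻¹ {[]} {z ∷ W} s _ (inj₁ refl ∷ _) (inj₂ refl) eq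
    with () ← zeros-a-after-b (1 ∷ ϕ* W) 1 s (trans (sym (ϕ-run-++ 0 (ϕ* W))) eq)
  ϕ*-prefix⁻¹ {[]} {z ∷ W} s _ (inj₂ refl ∷ _) (inj₁ refl) eq
    with () ← ++-cancelˡ B (1 ∷ ϕ* W) (0 ∷ s) (trans (sym (ϕ-run-++ 1 (ϕ* W))) eq)
  ϕ*-prefix⁻¹ {x ∷ v} {[]} {y} s _ _ _ eq =
    ⊥-elim ([]≢++∷ (ϕ* (x ∷ v) ++ B) (trans eq (sym (++-assoc (ϕ* (x ∷ v)) B (y ∷ s)))))
  ϕ*-prefix⁻¹ {x ∷ v} {z ∷ W} {y} s (bit-x ∷ bin-v) (bit-z ∷ bin-W) bit-y eq
    with run≡ , eq′ ← zeros-1-injective (run z) (run x) (ϕ* W) (ϕ* v ++ B ++ y ∷ s) (begin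
      zeros (run z) ++ 1 ∷ ϕ* W      ≡⟨ ϕ-run-++ z (ϕ* W) ⟨
      ϕ* (z ∷ W)                     ≡⟨ eq ⟩
      (ϕ x ++ ϕ* v) ++ B ++ y ∷ s    ≡⟨ ++-assoc (ϕ x) (ϕ* v) (B ++ y ∷ s) ⟩
      ϕ x ++ ϕ* v ++ B ++ y ∷ s      ≡⟨ ϕ-run-++ x _ ⟩
      zeros (run x) ++ 1 ∷ ϕ* v ++ B ++ y ∷ s ∎)
    with refl ← run-injective bit-z bit-x run≡
    with W′ , refl ← ϕ*-prefix⁻¹ s bin-v bin-W bit-y eq′ = W′ , refl

  ψ* : Word → Word
  ψ* = concatMap (λ z → 1 ∷ zeros (run z))

  ψ*-++ : ∀ v w → ψ* (v ++ w) ≡ ψ* v ++ ψ* w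
  ψ*-++ []      w = refl
  ψ*-++ (x ∷ v) w = cong (1 ∷_) (trans (cong (zeros (run x) ++_) (ψ*-++ v w))
                                        (sym (++-assoc (zeros (run x)) (ψ* v) (ψ* w))))

  reverse-ϕ* : ∀ W → reverse (ϕ* W) ≡ ψ* (reverse W)
  reverse-ϕ* []      = refl
  reverse-ϕ* (z ∷ W) = begin
    reverse (ϕ z ++ ϕ* W)                        ≡⟨ reverse-++ (ϕ z) (ϕ* W) ⟩
    reverse (ϕ* W) ++ reverse (ϕ z)              ≡⟨ cong₂ _++_ (reverse-ϕ* W) reverse-ϕ ⟩
    ψ* (reverse W) ++ 1 ∷ zeros (run z)          ≡⟨ cong (ψ* (reverse W) ++_) (++-identityʳ _) ⟨
    ψ* (reverse W) ++ ψ* [ z ]                   ≡⟨ ψ*-++ (reverse W) [ z ] ⟨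
    ψ* (reverse W ∷ʳ z)                          ≡⟨ cong ψ* (unfold-reverse z W) ⟨
    ψ* (reverse (z ∷ W))                         ∎
    where
    reverse-ϕ : reverse (ϕ z) ≡ 1 ∷ zeros (run z)
    reverse-ϕ = trans (cong reverse (ϕ-run z))
      (trans (reverse-++ (zeros (run z)) [ 1 ]) (cong (1 ∷_) (reverse-replicate (run z) 0)))

  ψ*-∷ʳ : ∀ R → ψ* R ∷ʳ 1 ≡ 1 ∷ ϕ* R
  ψ*-∷ʳ []      = refl
  ψ*-∷ʳ (z ∷ R) = cong (1 ∷_) (begin
    (zeros (run z) ++ ψ* R) ++ [ 1 ]   ≡⟨ ++-assoc (zeros (run z)) (ψ* R) [ 1 ] ⟩
    zeros (run z) ++ ψ* R ++ [ 1 ]     ≡⟨ cong (zeros (run z) ++_) (ψ*-∷ʳ R) ⟩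
    zeros (run z) ++ 1 ∷ ϕ* R          ≡⟨ ϕ-run-++ z (ϕ* R) ⟨
    ϕ z ++ ϕ* R                        ∎)

  -- Mirror image of ϕ*-prefix⁻¹: x 0ᵇ 1 at the end of a ϕ*-image can only end ϕ(x).
  ϕ*-suffix⁻¹ : ∀ {W x} p → Binary W → Bit x → ϕ* W ≡ p ++ x ∷ B ++ [ 1 ] → ∃ λ W′ → W ≡ W′ ∷ʳ x
  ϕ*-suffix⁻¹ {W} {x} p bin-W bit-x eq with initLast W
  ... | []       = ⊥-elim ([]≢++∷ p eq)
  ... | W′ ∷ʳ′ z with bit-z ∷ [] ← All.++⁻ʳ W′ bin-W = W′ , cong (W′ ∷ʳ_) (last-letter bit-z bit-x mirrored)
    where
    mirrored : zeros (run z) ++ ψ* (reverse W′) ≡ B ++ x ∷ reverse p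
    mirrored = ∷-injectiveʳ (begin
      ψ* (z ∷ reverse W′)                    ≡⟨ cong ψ* (reverse-++ W′ [ z ]) ⟨
      ψ* (reverse (W′ ∷ʳ z))                 ≡⟨ reverse-ϕ* (W′ ∷ʳ z) ⟨
      reverse (ϕ* (W′ ∷ʳ z))                 ≡⟨ cong reverse eq ⟩
      reverse (p ++ x ∷ B ++ [ 1 ])          ≡⟨ reverse-++ p (x ∷ B ++ [ 1 ]) ⟩
      reverse (x ∷ B ++ [ 1 ]) ++ reverse p  ≡⟨ cong (_++ reverse p) (reverse-∷-∷ʳ x B 1) ⟩
      (1 ∷ reverse B ++ [ x ]) ++ reverse p  ≡⟨ cong (λ v → (1 ∷ v ++ [ x ]) ++ reverse p) (reverse-replicate b 0) ⟩
      (1 ∷ B ++ [ x ]) ++ reverse p          ≡⟨ cong (1 ∷_) (++-assoc B [ x ] (reverse p)) ⟩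
      1 ∷ B ++ x ∷ reverse p                 ∎)
    last-letter : ∀ {z x} → Bit z → Bit x → zeros (run z) ++ ψ* (reverse W′) ≡ B ++ x ∷ reverse p → z ≡ x
    last-letter (inj₁ refl) (inj₁ refl) _  = refl
    last-letter (inj₂ refl) (inj₂ refl) _  = refl
    last-letter (inj₁ refl) (inj₂ refl) eq′ with () ← zeros-a-after-b (ψ* (reverse W′)) 1 (reverse p) eq′
    last-letter (inj₂ refl) (inj₁ refl) eq′ with reverse W′ | ++-cancelˡ B _ (0 ∷ reverse p) eq′
    ... | []    | ()
    ... | _ ∷ _ | ()

  T : Word → Word
  T v = B ++ 1 ∷ ϕ* v ++ B

  reverse-T : ∀ v → reverse (T v) ≡ T (reverse v)
  reverse-T v = begin
    reverse (B ++ 1 ∷ ϕ* v ++ B)                     ≡⟨ reverse-++ B (1 ∷ ϕ* v ++ B) ⟩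
    reverse (1 ∷ ϕ* v ++ B) ++ reverse B             ≡⟨ cong (_++ reverse B) (unfold-reverse 1 (ϕ* v ++ B)) ⟩
    (reverse (ϕ* v ++ B) ∷ʳ 1) ++ reverse B          ≡⟨ cong (λ u → (u ∷ʳ 1) ++ reverse B) (reverse-++ (ϕ* v) B) ⟩
    ((reverse B ++ reverse (ϕ* v)) ∷ʳ 1) ++ reverse B ≡⟨ cong₂ (λ u u′ → ((u ++ u′) ∷ʳ 1) ++ u) (reverse-replicate b 0) (reverse-ϕ* v) ⟩
    ((B ++ ψ* (reverse v)) ∷ʳ 1) ++ B                ≡⟨ solve 3 (λ X Y Z → ((X ⊕ Y) ⊕ Z) ⊕ X ⊜ X ⊕ (Y ⊕ Z) ⊕ X) refl B (ψ* (reverse v)) [ 1 ] ⟩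
    B ++ (ψ* (reverse v) ∷ʳ 1) ++ B                  ≡⟨ cong (λ u → B ++ u ++ B) (ψ*-∷ʳ (reverse v)) ⟩
    T (reverse v)                                    ∎

  ϕ-prefix : ∀ {y} → Bit y → ∃ λ s → ϕ y ≡ B ++ y ∷ s
  ϕ-prefix (inj₁ refl) = zeros (suc e) ++ [ 1 ] ,
    trans (cong (_++ [ 1 ]) zeros-a-left) (++-assoc B (0 ∷ zeros (suc e)) [ 1 ])
  ϕ-prefix (inj₂ refl) = [] , refl

  ϕϕ-suffix : ∀ z {x} → Bit x → ∃ λ p → ϕ z ++ ϕ x ≡ p ++ x ∷ B ++ [ 1 ]
  ϕϕ-suffix z (inj₁ refl) = ϕ z ++ zeros (suc e) , (begin
    ϕ z ++ zeros a ++ [ 1 ]                         ≡⟨ cong (λ u → ϕ z ++ u ++ [ 1 ]) zeros-a-right ⟩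
    ϕ z ++ (zeros (suc e) ++ 0 ∷ B) ++ [ 1 ]        ≡⟨ solve 5 (λ P Q Z R I → P ⊕ (Q ⊕ Z ⊕ R) ⊕ I ⊜ (P ⊕ Q) ⊕ Z ⊕ R ⊕ I)
                                                         refl (ϕ z) (zeros (suc e)) [ 0 ] B [ 1 ] ⟩
    (ϕ z ++ zeros (suc e)) ++ 0 ∷ B ++ [ 1 ]        ∎)
  ϕϕ-suffix z (inj₂ refl) = zeros (run z) , ϕ-run-++ z (ϕ 1)

  T-extension⁺ : ∀ {x y v} → Bit x → Bit y → Factor (x ∷ v ++ [ y ]) → Factor (x ∷ T v ++ [ y ])
  T-extension⁺ {x} {y} {v} bit-x bit-y xvy
    with z , _ , k , zxvy⊑U ← extendˡ xvy
    with p , ϕzx≡ ← ϕϕ-suffix z bit-x | s , ϕy≡ ← ϕ-prefix bit-y =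
    suc k , ⊑-trans (p , s , xTvy⊑) (⊑-ϕ* zxvy⊑U)
    where
    xTvy⊑ : p ++ (x ∷ T v ++ [ y ]) ++ s ≡ ϕ* (z ∷ x ∷ v ++ [ y ])
    xTvy⊑ = begin
      p ++ (x ∷ (B ++ 1 ∷ ϕ* v ++ B) ++ [ y ]) ++ s
        ≡⟨ solve 7 (λ P X Bb O V Y S → P ⊕ (X ⊕ (Bb ⊕ O ⊕ V ⊕ Bb) ⊕ Y) ⊕ S ⊜ (P ⊕ X ⊕ Bb ⊕ O) ⊕ V ⊕ (Bb ⊕ Y ⊕ S) ⊕ ε)
             refl p [ x ] B [ 1 ] (ϕ* v) [ y ] s ⟩
      (p ++ x ∷ B ++ [ 1 ]) ++ ϕ* v ++ (B ++ y ∷ s) ++ []   ≡⟨ cong₂ (λ u u′ → u ++ ϕ* v ++ u′ ++ []) ϕzx≡ ϕy≡ ⟨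
      (ϕ z ++ ϕ x) ++ ϕ* v ++ ϕ* [ y ]                     ≡⟨ ++-assoc (ϕ z) (ϕ x) _ ⟩
      ϕ z ++ ϕ x ++ ϕ* v ++ ϕ* [ y ]                       ≡⟨ cong (λ u → ϕ z ++ ϕ x ++ u) (ϕ*-++ v [ y ]) ⟨
      ϕ* (z ∷ x ∷ v ++ [ y ])                              ∎

  T-extension⁻ : ∀ {x y v} → Bit x → Bit y → Binary v → Factor (x ∷ T v ++ [ y ]) → Factor (x ∷ v ++ [ y ])
  T-extension⁻ {x} {y} {v} bit-x bit-y bin-v xTvy
    with k , p , s , eq ← Factor-ϕ* xTvy
    with W₁ , W₂ , U≡ , ϕW₁≡ , ϕW₂≡ ← ϕ*-split-at-1 (U k) (p ++ x ∷ B) (ϕ* v ++ B ++ y ∷ s) (trans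
      (solve 7 (λ P X Bb O V Y S → (P ⊕ X ⊕ Bb) ⊕ O ⊕ V ⊕ Bb ⊕ Y ⊕ S ⊜ P ⊕ (X ⊕ (Bb ⊕ O ⊕ V ⊕ Bb) ⊕ Y) ⊕ S)
             refl p [ x ] B [ 1 ] (ϕ* v) [ y ] s) eq)
    with bin-W₁ , bin-W₂ ← All.++⁻ W₁ (subst Binary U≡ (Binary-U k))
    with W₃ , refl ← ϕ*-prefix⁻¹ s bin-v bin-W₂ bit-y ϕW₂≡
    with W₀ , refl ← ϕ*-suffix⁻¹ p bin-W₁ bit-x (trans ϕW₁≡ (++-assoc p (x ∷ B) [ 1 ])) =
    k , W₀ , W₃ , trans (solve 5 (λ W X V Y W′ → W ⊕ (X ⊕ V ⊕ Y) ⊕ W′ ⊜ (W ⊕ X) ⊕ V ⊕ Y ⊕ W′) refl W₀ [ x ] v [ y ] W₃) (sym U≡)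

  Factor-T : ∀ {v} → Factor v → Factor (T v)
  Factor-T v with x , bit-x , xv ← extendˡ v with y , bit-y , xvy ← extendʳ xv =
    Factor-⊑ (⊑-++ [ x ] _ [ y ]) (T-extension⁺ bit-x bit-y xvy)

  -- Every factor lies in the palindromic factor Tⁿ k, so the language is closed under reversal.
  Tⁿ : ℕ → Word
  Tⁿ zero    = [ 0 ]
  Tⁿ (suc k) = T (Tⁿ k)

  Factor-Tⁿ : ∀ k → Factor (Tⁿ k)
  Factor-Tⁿ zero    = 0 , ⊑-refl [ 0 ]
  Factor-Tⁿ (suc k) = Factor-T (Factor-Tⁿ k)

  Tⁿ-palindrome : ∀ k → reverse (Tⁿ k) ≡ Tⁿ k
  Tⁿ-palindrome zero    = refl
  Tⁿ-palindrome (suc k) = trans (reverse-T (Tⁿ k)) (cong T (Tⁿ-palindrome k))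

  U⊑Tⁿ : ∀ k → U k ⊑ Tⁿ k
  U⊑Tⁿ zero    = ⊑-refl [ 0 ]
  U⊑Tⁿ (suc k) = ⊑-trans (⊑-ϕ* (U⊑Tⁿ k)) (B ++ [ 1 ] , B , ++-assoc B [ 1 ] _)

  Factor-reverse : ∀ {w} → Factor w → Factor (reverse w)
  Factor-reverse {w} (k , w⊑U) = Factor-⊑
    (subst (reverse w ⊑_) (Tⁿ-palindrome k) (⊑-reverse (⊑-trans w⊑U (U⊑Tⁿ k)))) (Factor-Tⁿ k)

  zeros-before-1 : ∀ k m {s t} → zeros k ++ s ≡ m ++ 1 ∷ t → k ≤ length m
  zeros-before-1 zero    m       eq = z≤n
  zeros-before-1 (suc k) (_ ∷ m) eq = s≤s (zeros-before-1 k m (∷-injectiveʳ eq))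

  zero-run-in-ϕ* : ∀ W p k s → p ++ zeros k ++ s ≡ ϕ* W → k ≤ a
  zero-run-in-ϕ* W       p zero    s eq = z≤n
  zero-run-in-ϕ* []      p (suc k) s eq = ⊥-elim ([]≢++∷ p (sym eq))
  zero-run-in-ϕ* (z ∷ W) p (suc k) s eq
    with ++-overlap p (zeros (suc k) ++ s) (zeros (run z)) (1 ∷ ϕ* W) (trans eq (ϕ-run-++ z (ϕ* W)))
  ... | inj₁ (_ ∷ m , _ , eq′) = zero-run-in-ϕ* W m (suc k) s (sym (∷-injectiveʳ eq′))
  ... | inj₂ (m , zeros≡ , eq′) =
    ≤-trans (zeros-before-1 (suc k) m eq′) (≤-trans (m≤n+m _ (length p)) (≤-trans (≤-reflexive p++m≡) (run≤a z)))
    where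
    p++m≡ : length p + length m ≡ run z
    p++m≡ = trans (sym (length-++ p)) (trans (cong length (sym zeros≡)) (length-replicate (run z)))

  zero-run≤a : ∀ k → Factor (zeros k) → k ≤ a
  zero-run≤a k 0ᵏ with k′ , p , s , eq ← Factor-ϕ* 0ᵏ = zero-run-in-ϕ* (U k′) p k s eq

  isolated-zero-run : ∀ k → Factor (1 ∷ zeros k ++ [ 1 ]) → k ≡ a ⊎ k ≡ b
  isolated-zero-run k 10ᵏ1 with k′ , p , s , eq ← Factor-ϕ* 10ᵏ1
    with ϕ*-split-at-1 (U k′) p (zeros k ++ 1 ∷ s) (trans (cong (λ t → p ++ 1 ∷ t) (sym (++-assoc (zeros k) [ 1 ] s))) eq)
  ... | _ , []    , _ , _ , ϕW≡ = ⊥-elim ([]≢++∷ (zeros k) ϕW≡)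
  ... | _ , z ∷ W , _ , _ , ϕW≡ =
    run-value z (proj₁ (zeros-1-injective (run z) k (ϕ* W) s (trans (sym (ϕ-run-++ z (ϕ* W))) ϕW≡)))
    where
    run-value : ∀ z → run z ≡ k → k ≡ a ⊎ k ≡ b
    run-value zero    = inj₁ ∘ sym
    run-value (suc _) = inj₂ ∘ sym

  Factor-0B1 : Factor (0 ∷ B ++ [ 1 ])
  Factor-0B1 = 1 , zeros (suc e) , [] , (begin
    zeros (suc e) ++ (0 ∷ B ++ [ 1 ]) ++ []      ≡⟨ solve 4 (λ R Z Bb O → R ⊕ (Z ⊕ Bb ⊕ O) ⊕ ε ⊜ ((R ⊕ Z ⊕ Bb) ⊕ O) ⊕ ε)
                                                      refl (zeros (suc e)) [ 0 ] B [ 1 ] ⟩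
    ((zeros (suc e) ++ 0 ∷ B) ++ [ 1 ]) ++ []    ≡⟨ cong (λ t → (t ++ [ 1 ]) ++ []) zeros-a-right ⟨
    ϕ* [ 0 ]                                     ∎)

  bounded-isolated-run : ∀ {i} → Factor (zeros (suc i)) → Factor (1 ∷ zeros i ++ [ 1 ]) → i ≡ b
  bounded-isolated-run {i} 0ⁱ⁺¹ 10ⁱ1 with isolated-zero-run i 10ⁱ1
  ... | inj₂ i≡b  = i≡b
  ... | inj₁ refl = ⊥-elim (<-irrefl refl (zero-run≤a (suc a) 0ⁱ⁺¹))

  leading-run : ∀ {i R} → Factor (0 ∷ zeros i ++ 1 ∷ R) → Factor (1 ∷ zeros i ++ 1 ∷ R) → i ≡ b
  leading-run {i} {R} 0w 1w = bounded-isolated-run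
    (Factor-⊑ ([] , 1 ∷ R , refl) 0w)
    (Factor-⊑ ([] , R , cong (1 ∷_) (++-assoc (zeros i) [ 1 ] R)) 1w)

  NoTrailing0 : Word → Set
  NoTrailing0 M = M ≡ [] ⊎ ∃ λ m → M ≡ m ∷ʳ 1

  1∷-NoTrailing0 : ∀ {M} → NoTrailing0 M → ∃ λ q → 1 ∷ M ≡ q ∷ʳ 1
  1∷-NoTrailing0 (inj₁ refl)       = [] , refl
  1∷-NoTrailing0 (inj₂ (m , refl)) = 1 ∷ m , refl

  trailing-run : ∀ {u M j} → NoTrailing0 M →
    Factor ((u ++ 1 ∷ M ++ zeros j) ++ [ 0 ]) → Factor ((u ++ 1 ∷ M ++ zeros j) ++ [ 1 ]) → j ≡ b
  trailing-run {u} {M} {j} noTrailing w0 w1 with q , 1M≡ ← 1∷-NoTrailing0 noTrailing =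
    bounded-isolated-run (Factor-⊑ (u ++ 1 ∷ M , [] , 0ʲ⁺¹-suffix) w0) (Factor-⊑ (u ++ q , [] , 10ʲ1-suffix) w1)
    where
    0ʲ⁺¹-suffix : (u ++ 1 ∷ M) ++ zeros (suc j) ++ [] ≡ (u ++ 1 ∷ M ++ zeros j) ++ [ 0 ]
    0ʲ⁺¹-suffix = begin
      (u ++ 1 ∷ M) ++ (0 ∷ zeros j) ++ []  ≡⟨ cong ((u ++ 1 ∷ M) ++_) (trans (++-identityʳ _) (sym (replicate-∷ʳ j 0))) ⟩
      (u ++ 1 ∷ M) ++ zeros j ++ [ 0 ]     ≡⟨ solve 4 (λ U O Z N → (U ⊕ O) ⊕ Z ⊕ N ⊜ (U ⊕ O ⊕ Z) ⊕ N) refl u (1 ∷ M) (zeros j) [ 0 ] ⟩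
      (u ++ 1 ∷ M ++ zeros j) ++ [ 0 ]     ∎
    10ʲ1-suffix : (u ++ q) ++ (1 ∷ zeros j ++ [ 1 ]) ++ [] ≡ (u ++ 1 ∷ M ++ zeros j) ++ [ 1 ]
    10ʲ1-suffix = begin
      (u ++ q) ++ (1 ∷ zeros j ++ [ 1 ]) ++ []  ≡⟨ solve 4 (λ U Q O Z → (U ⊕ Q) ⊕ (O ⊕ Z ⊕ O) ⊕ ε ⊜ (U ⊕ Q ⊕ O) ⊕ Z ⊕ O)
                                                     refl u q [ 1 ] (zeros j) ⟩
      (u ++ q ∷ʳ 1) ++ zeros j ++ [ 1 ]         ≡⟨ cong (λ t → (u ++ t) ++ zeros j ++ [ 1 ]) 1M≡ ⟨
      (u ++ 1 ∷ M) ++ zeros j ++ [ 1 ]          ≡⟨ solve 4 (λ U O Z N → (U ⊕ O) ⊕ Z ⊕ N ⊜ (U ⊕ O ⊕ Z) ⊕ N) refl u (1 ∷ M) (zeros j) [ 1 ] ⟩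
      (u ++ 1 ∷ M ++ zeros j) ++ [ 1 ]          ∎

  first-1 : ∀ {w} → Binary w → (∃ λ k → w ≡ zeros k) ⊎ (∃₂ λ i r → w ≡ zeros i ++ 1 ∷ r)
  first-1 []                = inj₁ (0 , refl)
  first-1 (inj₂ refl ∷ _)   = inj₂ (0 , _ , refl)
  first-1 (inj₁ refl ∷ bin) with first-1 bin
  ... | inj₁ (k , refl)     = inj₁ (suc k , refl)
  ... | inj₂ (i , r , refl) = inj₂ (suc i , r , refl)

  last-1 : ∀ {r} → Binary r → (∃ λ j → r ≡ zeros j) ⊎ (∃₂ λ m j → r ≡ (m ∷ʳ 1) ++ zeros j)
  last-1 []                = inj₁ (0 , refl)
  last-1 (_∷_ {x} bit bin) with last-1 bin | bit
  ... | inj₁ (j , refl)     | inj₁ refl = inj₁ (suc j , refl)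
  ... | inj₁ (j , refl)     | inj₂ refl = inj₂ ([] , j , refl)
  ... | inj₂ (m , j , refl) | _         = inj₂ (x ∷ m , j , refl)

  outer-runs : ∀ {w} → Binary w →
    (∃ λ k → w ≡ zeros k) ⊎ (∃ λ i → ∃ λ M → ∃ λ j → NoTrailing0 M × w ≡ zeros i ++ 1 ∷ M ++ zeros j)
  outer-runs bin with first-1 bin
  ... | inj₁ zeros-k = inj₁ zeros-k
  ... | inj₂ (i , r , refl) with _ ∷ bin-r ← All.++⁻ʳ (zeros i) bin with last-1 bin-r
  ...   | inj₁ (j , refl)     = inj₂ (i , [] , j , inj₁ refl , refl)
  ...   | inj₂ (m , j , refl) = inj₂ (i , m ∷ʳ 1 , j , inj₂ (m , refl) , refl)

  -- Cutting an occurrence in ϕ*(U k) right after 0ᵇ1 and right after M's last 1 isolates M as a ϕ*-image.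
  ϕ*-preimage : ∀ {M Z} → NoTrailing0 M → Factor (B ++ 1 ∷ M ++ Z) → ∃ λ v → Binary v × ϕ* v ≡ M
  ϕ*-preimage (inj₁ refl) _ = [] , [] , refl
  ϕ*-preimage {Z = Z} (inj₂ (m , refl)) B1M with k , p , s , eq ← Factor-ϕ* B1M
    with W₁ , W₂ , U≡ , _ , ϕW₂≡ ← ϕ*-split-at-1 (U k) (p ++ B) ((m ∷ʳ 1) ++ Z ++ s)
           (trans (solve 6 (λ P Bb O M Z S → (P ⊕ Bb) ⊕ O ⊕ (M ⊕ O) ⊕ Z ⊕ S ⊜ P ⊕ (Bb ⊕ O ⊕ (M ⊕ O) ⊕ Z) ⊕ S)
                     refl p B [ 1 ] m Z s) eq)
    with V , _ , refl , ϕV≡ , _ ← ϕ*-split-at-1 W₂ m (Z ++ s) (sym (trans ϕW₂≡ (++-assoc m [ 1 ] (Z ++ s)))) =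
    V , All.++⁻ˡ V (All.++⁻ʳ W₁ (subst Binary U≡ (Binary-U k))) , ϕV≡

  Good : Word → Set
  Good w = IsPalindrome w × ¬ WeakSymmetric Factor w

  -- 0ᵏ⁺² and 10ᵏ1 force k = b, and then 00ᵏ1 is a factor.
  zeros-good : ∀ k → Good (zeros k)
  zeros-good k = sym (reverse-replicate k 0) , λ (00ᵏ0 , 10ᵏ1 , ¬00ᵏ1 , _) →
    case-b (bounded-isolated-run (Factor-tail (subst Factor (cong (0 ∷_) (replicate-∷ʳ k 0)) 00ᵏ0)) 10ᵏ1) ¬00ᵏ1
    where
    case-b : k ≡ b → ¬ Factor (0 ∷ zeros k ++ [ 1 ]) → ⊥
    case-b refl ¬00ᵏ1 = ¬00ᵏ1 Factor-0B1

  T-bispecial⁻ : ∀ {v} → Binary v → Bispecial Factor (T v) → Bispecial Factor v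
  T-bispecial⁻ bin-v (0T , 1T , T0 , T1)
    with y₀ , bit-y₀ , 0Ty₀ ← extendʳ 0T | y₁ , bit-y₁ , 1Ty₁ ← extendʳ 1T
       | x₀ , bit-x₀ , x₀T0 ← extendˡ T0 | x₁ , bit-x₁ , x₁T1 ← extendˡ T1 =
    Factor-init (T-extension⁻ (inj₁ refl) bit-y₀ bin-v 0Ty₀) ,
    Factor-init (T-extension⁻ (inj₂ refl) bit-y₁ bin-v 1Ty₁) ,
    Factor-tail (T-extension⁻ bit-x₀ (inj₁ refl) bin-v x₀T0) ,
    Factor-tail (T-extension⁻ bit-x₁ (inj₂ refl) bin-v x₁T1)

  T-good : ∀ {v} → Binary v → Good v → Good (T v)
  T-good {v} bin-v (pal , ¬weak) = sym (trans (reverse-T v) (cong T (sym pal))) ,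
    λ (0T0 , 1T1 , ¬0T1 , ¬1T0) → ¬weak
      ( T-extension⁻ (inj₁ refl) (inj₁ refl) bin-v 0T0 , T-extension⁻ (inj₂ refl) (inj₂ refl) bin-v 1T1
      , ¬0T1 ∘ T-extension⁺ (inj₁ refl) (inj₂ refl) , ¬1T0 ∘ T-extension⁺ (inj₂ refl) (inj₁ refl))

  length-T : ∀ v → length v < length (T v)
  length-T v rewrite length-++ B {1 ∷ ϕ* v ++ B} | length-++ (ϕ* v) {B} =
    ≤-trans (s≤s (≤-trans (m≤m+n (length v) (length v)) (≤-trans (length-ϕ* v) (m≤m+n _ _)))) (m≤n+m _ (length B))

  bispecial-shape : ∀ {w} → Bispecial Factor w → (∃ λ k → w ≡ zeros k) ⊎ (∃ λ v → Binary v × w ≡ T v)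
  bispecial-shape (0w , 1w , w0 , w1) with outer-runs (Factor-binary (Factor-tail 0w))
  ... | inj₁ zeros-k = inj₁ zeros-k
  ... | inj₂ (i , M , j , noTrailing , refl)
    with refl ← leading-run 0w 1w | refl ← trailing-run noTrailing w0 w1
    with v , bin-v , refl ← ϕ*-preimage noTrailing (Factor-tail 1w) = inj₂ (v , bin-v , refl)

  bispecial-good : ∀ {w} → Bispecial Factor w → Good w
  bispecial-good {w} = by-length (suc (length w)) ≤-refl
    where
    by-length : ∀ n {w} → length w < n → Bispecial Factor w → Good w
    by-length (suc n) |w|≤n bisp with bispecial-shape bisp
    ... | inj₁ (k , refl)         = zeros-good k
    ... | inj₂ (v , bin-v , refl) =
      T-good bin-v (by-length n (≤-trans (length-T v) (≤-pred |w|≤n)) (T-bispecial⁻ bin-v bisp))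

  short-factor-in-U₂ : ∀ {s} → Factor s → length s ≤ 2 → s ⊑ U 2
  short-factor-in-U₂ {[]} _ _ = [] , U 2 , refl
  short-factor-in-U₂ {_ ∷ []} fac _ with Factor-binary fac
  ... | inj₁ refl ∷ [] with t , U₂≡ ← U-head 2 = [] , t , sym U₂≡
  ... | inj₂ refl ∷ [] = ⊑-U 1 1 (zeros a , [] , sym (++-assoc (zeros a) [ 1 ] []))
  short-factor-in-U₂ {_ ∷ _ ∷ []} fac _ with Factor-binary fac
  ... | inj₁ refl ∷ inj₁ refl ∷ [] = ⊑-U 1 1 ([] , _ , refl)
  ... | inj₁ refl ∷ inj₂ refl ∷ [] = ⊑-U 1 1 (zeros (suc (e + b)) , [] , (begin
    zeros (suc (e + b)) ++ (0 ∷ [ 1 ]) ++ []      ≡⟨ solve 3 (λ Z O I → Z ⊕ (O ⊕ I) ⊕ ε ⊜ ((Z ⊕ O) ⊕ I) ⊕ ε) refl (zeros (suc (e + b))) [ 0 ] [ 1 ] ⟩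
    ((zeros (suc (e + b)) ∷ʳ 0) ++ [ 1 ]) ++ []   ≡⟨ cong (λ t → (t ++ [ 1 ]) ++ []) (replicate-∷ʳ (suc (e + b)) 0) ⟩
    U 1                                          ∎))
  ... | inj₂ refl ∷ inj₁ refl ∷ [] with R , U₂≡ ← U-suc 1 | t , U₁≡ ← U-head 1 = zeros a , t ++ R , (begin
    zeros a ++ (1 ∷ [ 0 ]) ++ t ++ R   ≡⟨ solve 4 (λ Z O T R → Z ⊕ (O ⊕ T) ⊕ R ⊜ ((Z ⊕ O) ⊕ ε) ⊕ T ⊕ R) refl (zeros a) [ 1 ] (0 ∷ t) R ⟩
    U 1 ++ (0 ∷ t) ++ R                ≡⟨ cong (λ u → U 1 ++ u ++ R) U₁≡ ⟨
    U 1 ++ U 1 ++ R                    ≡⟨ U₂≡ ⟨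
    U 2                                ∎)
  ... | inj₂ refl ∷ inj₂ refl ∷ [] with isolated-zero-run 0 fac
  ...   | inj₂ 0≡b with () ← subst (1 ≤_) (sym 0≡b) b≥1
  short-factor-in-U₂ {_ ∷ _ ∷ _ ∷ _} _ (s≤s (s≤s ()))

  -- Desubstituting |w| times leaves a factor of length ≤ 2, and all of those occur in U 2.
  Factor-in-U : ∀ {w} → Factor w → w ⊑ U (length w + 2)
  Factor-in-U {w} (k , w⊑U)
    with s , s⊑U , |s|≤2 , w⊑ ← ⊑-image-of-two-letters (iter a b (length w)) (iter-[] (length w)) (iter-++ (length w))
                                  (λ x → ≤-trans (n≤1+n _) (length-iter (length w) x)) (U k)
                                  (subst (w ⊑_) (iter-+ (length w) k [ 0 ]) (⊑-U (length w) k w⊑U)) =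
    subst (w ⊑_) (sym (iter-+ (length w) 2 [ 0 ])) (⊑-trans w⊑ (⊑-iter (length w) (short-factor-in-U₂ (k , s⊑U) |s|≤2)))

  Factor? : Decidable Factor
  Factor? w = map′ (length w + 2 ,_) Factor-in-U ((_≟_ ⊑? w) (U (length w + 2)))

  U-prefix-at : ∀ j k {i} → i < length (U k) → at (U (j + k)) i ≡ at (U k) i
  U-prefix-at j k i< with t , eq ← U-prefix j k = trans (cong (λ W → at W _) (sym eq)) (at-++ (U k) t i<)

  U-PrefixOf-u : ∀ k → PrefixOf (U k) (u a b)
  U-PrefixOf-u k i i< = begin
    at (U (suc i)) i         ≡⟨ U-prefix-at k (suc i) (≤-trans (n≤1+n (suc i)) (length-iter (suc i) 0)) ⟨
    at (U (k + suc i)) i     ≡⟨ cong (λ n → at (U n) i) (+-comm k (suc i)) ⟩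
    at (U (suc i + k)) i     ≡⟨ U-prefix-at (suc i) k i< ⟩
    at (U k) i               ∎

  Factor⇔IsFactor : ∀ {w} → IsFactor (u a b) w ⇔ Factor w
  Factor⇔IsFactor {w} = mk⇔
    (λ (i , window≡) → i + length w ,
      subst (_⊑ U (i + length w)) window≡
        (window-⊑ i (length w) (U-PrefixOf-u (i + length w)) (≤-trans (n≤1+n _) (length-iter (i + length w) 0))))
    (λ (k , p , s , eq) → length p , window-at-occurrence p w s (U-PrefixOf-u k) eq)

  open PalindromicComplexity Factor Factor? Factor-tail Factor-init extendˡ extendʳ Factor-reverse bispecial-good
    (0 , ⊑-refl [ 0 ]) (1 , zeros a , [] , sym (++-assoc (zeros a) [ 1 ] []))
    public using (PalL?; C; P; palindromic-complexity)

  complexity : ∀ n → ComplexityIs a b n (C n)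
  complexity n = sumWords-HasCard n Factor? Factor-binary Factor⇔IsFactor

  palindromic-factors : ∀ n → PalCountIs a b n (P n)
  palindromic-factors n = sumWords-HasCard n PalL? (Factor-binary ∘ proj₁) (Factor⇔IsFactor ×-⇔ ⇔-refl)

gap-decomposition : ∀ {a b} → b + 1 < a → ∃ λ e → a ≡ suc (suc (e + b))
gap-decomposition {b = b} b+1<a with e , eq ← m≤n⇒∃[o]m+o≡n b+1<a =
  e , trans (sym eq) (cong suc (trans (cong (_+ e) (+-comm b 1)) (cong suc (+-comm b e))))

corollary5p8 : (a b : ℕ) → 1 ≤ b → b + 1 < a → (n : ℕ) →
    ∃ λ c₀ → ∃ λ c₁ → ∃ λ p₀ → ∃ λ p₁ →
    ComplexityIs a b n c₀ × ComplexityIs a b (suc n) c₁ ×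
    PalCountIs a b n p₀ × PalCountIs a b (suc n) p₁ ×
    p₁ + p₀ + c₀ ≡ c₁ + 2
corollary5p8 a b b≥1 b+1<a n with e , refl ← gap-decomposition b+1<a =
  C n , C (suc n) , P n , P (suc n) ,
  complexity n , complexity (suc n) , palindromic-factors n , palindromic-factors (suc n) ,
  palindromic-complexity n
  where open FixedPoint b e b≥1
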